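{- Let $a$ be an array of distinct numbers, and let its elements be partitioned into sets $S$ and $N$ such that the subsequence formed by $N$ is increasing. For each element $a_i \in N$, define its label $I(a_i) \subseteq S$ to be the set of elements $a_j\in S$ such that $(a_i,a_j)$ is an inversion. Then $$\Big|\bigcup_{a_i \in N} \{I(a_i)\}\Big| \leq 2|S|+1,$$ i.e., there are at most $2|S|+1$ distinct labels.
   Context: A pair of elements $a_i,a_j$ with $i<j$ is an inversion if $a_i>a_j$ (the pair is regarded as unordered when referring to it). -}

module Defs where

open import Data.Nat using (ℕ) renaming (_<_ to _<ℕ_; _<?_ to _<ℕ?_)
open import Data.Fin using (Fin; _<_; _<?_)
open import Data.Fin.Subset using (Subset; _∈_; _∉_)
open import Data.Fin.Subset.Properties using (_∈?_)
open import Data.Vec using (tabulate)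
open import Data.Vec.Properties using (≡-dec)
open import Data.Bool using (Bool; _∧_) renaming (_≟_ to _≟B_)
open import Data.List using (List; map; filter; length; deduplicate)
open import Data.List.Base using () renaming (allFin to allFinL)
open import Data.Product using (_×_)
open import Data.Sum using (_⊎_)
open import Relation.Nullary using (does; ¬?)
open import Relation.Nullary.Decidable using (_×-dec_; _⊎-dec_)

Array : ℕ → Set
Array n = Fin n → ℕ

Inversion : ∀ {n} → Array n → Fin n → Fin n → Set
Inversion a i j = (i < j × a j <ℕ a i) ⊎ (j < i × a i <ℕ a j)

inversion? : ∀ {n} (a : Array n) (i j : Fin n) → Bool
inversion? a i j = does ((i <? j ×-dec a j <ℕ? a i) ⊎-dec (j <? i ×-dec a i <ℕ? a j))

label : ∀ {n} → Array n → Subset n → Fin n → Subset n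
label a S i = tabulate (λ j → does (j ∈? S) ∧ inversion? a i j)

labelsOfN : ∀ {n} → Array n → Subset n → List (Subset n)
labelsOfN {n} a S = map (label a S) (filter (λ i → ¬? (i ∈? S)) (allFinL n))

numDistinctLabels : ∀ {n} → Array n → Subset n → ℕ
numDistinctLabels a S = length (deduplicate (≡-dec _≟B_) (labelsOfN a S))

module Submission where

-- Walk through N in increasing order of position and record the labels as a sequence of
-- subsets of S. A new label can only appear where two consecutive labels differ, so the number
-- of distinct labels is at most 1 + the total Hamming variation of the sequence, which is the
-- sum over j ∈ S of the number of times membership of j flips. For i ∈ N, the pair (i, j) is an
-- inversion iff "j precedes i" xor "a_j < a_i"; both predicates are monotone along N (the
-- second because N is increasing), so membership of j flips at most twice.


open import Defs
open import Data.Nat using (ℕ; zero; suc; _≤_; _+_; _*_; z≤n; s≤s)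
  renaming (_<_ to _<ℕ_; _<?_ to _<ℕ?_)
open import Data.Nat.Properties
  using (≤-refl; ≤-trans; +-mono-≤; +-monoˡ-≤; m≤m+n; m≤n+m; *-suc; +-comm; <-trans; +-commutativeSemigroup; +-0-monoid; module ≤-Reasoning)
  renaming (<-cmp to <ℕ-cmp)
open import Data.Fin using (Fin; zero; suc; _<_; _<?_)
import Data.Fin.Properties as Fin
open import Data.Fin.Subset using (Subset; _∈_; _∉_; ∣_∣)
open import Data.Fin.Subset.Properties using (_∈?_)
open import Data.Bool.Properties using (∨-identityʳ)
open import Data.Bool using (Bool; true; false; not; _∧_; _∨_; _xor_; f≤t; b≤b)
  renaming (_≤_ to _≤ᵇ_; _≟_ to _≟ᵇ_)
open import Data.Vec using (Vec; []; _∷_; lookup; tail; here; there)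
open import Data.Vec.Properties using (≡-dec; lookup∘tabulate)
open import Data.List using (List; []; _∷_; map; filter; length; deduplicate; allFin)
open import Data.List.Properties using (length-filter; filter-reject; filter-idem; map-∘; map-cong; map-cong-local)
open import Data.List.Relation.Unary.All as All using (All; []; _∷_)
open import Data.List.Relation.Unary.All.Properties using (all-filter)
open import Data.List.Relation.Unary.Linked as Linked using (Linked; []; [-]; _∷_)
import Data.List.Relation.Unary.Linked.Properties as Linked
import Data.List.Relation.Unary.AllPairs.Properties as AllPairs
open import Algebra.Properties.CommutativeSemigroup +-commutativeSemigroup using (interchange)
open import Algebra.Properties.Monoid.Sum +-0-monoid using (sum-syntax; sum-cong-≗)
open import Function using (id; _∘_; const)
open import Function.Definitions using (Injective)
open import Relation.Binary.Definitions using (DecidableEquality; Trichotomous; tri<; tri≈; tri>)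
open import Relation.Binary.PropositionalEquality using (_≡_; _≢_; refl; sym; trans; cong; cong₂; module ≡-Reasoning)
open import Relation.Nullary using (Dec; yes; no; does; ¬?)
open import Relation.Nullary.Decidable using (dec-true; dec-false)
open import Relation.Nullary.Negation using (contradiction)

δ : Bool → Bool → ℕ
δ false false = 0
δ true  true  = 0
δ _     _     = 1

δ-refl : ∀ b → δ b b ≡ 0
δ-refl false = refl
δ-refl true  = refl

δ≤1 : ∀ b c → δ b c ≤ 1
δ≤1 false false = z≤n
δ≤1 false true  = ≤-refl
δ≤1 true  false = ≤-refl
δ≤1 true  true  = z≤n

≢⇒1≤δ : ∀ {b c} → b ≢ c → 1 ≤ δ b c
≢⇒1≤δ {false} {false} b≢c = contradiction refl b≢c
≢⇒1≤δ {false} {true}  _   = ≤-refl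
≢⇒1≤δ {true}  {false} _   = ≤-refl
≢⇒1≤δ {true}  {true}  b≢c = contradiction refl b≢c

δ-cong₂ : ∀ (g : Bool → Bool → Bool) b₁ b₂ c₁ c₂ →
          δ (g b₁ c₁) (g b₂ c₂) ≤ δ b₁ b₂ + δ c₁ c₂
δ-cong₂ g b₁ b₂ c₁ c₂ with b₁ ≟ᵇ b₂ | c₁ ≟ᵇ c₂
... | yes refl | yes refl rewrite δ-refl (g b₁ c₁) = z≤n
... | no b₁≢b₂ | _        = ≤-trans (δ≤1 _ _) (≤-trans (≢⇒1≤δ b₁≢b₂) (m≤m+n _ _))
... | yes _    | no c₁≢c₂ = ≤-trans (δ≤1 _ _) (≤-trans (≢⇒1≤δ c₁≢c₂) (m≤n+m _ _))

variation : ∀ {A : Set} → (A → A → ℕ) → List A → ℕ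
variation d []           = 0
variation d (x ∷ [])     = 0
variation d (x ∷ y ∷ xs) = d x y + variation d (y ∷ xs)

variation-const : ∀ {A B : Set} (d : B → B → ℕ) {b} → d b b ≡ 0 →
                  (xs : List A) → variation d (map (const b) xs) ≡ 0
variation-const d dbb≡0 []           = refl
variation-const d dbb≡0 (x ∷ [])     = refl
variation-const d dbb≡0 (x ∷ y ∷ xs) =
  cong₂ _+_ dbb≡0 (variation-const d dbb≡0 (y ∷ xs))

variation-map₂ : ∀ {A : Set} (g : Bool → Bool → Bool) (p q : A → Bool) xs →
                 variation δ (map (λ x → g (p x) (q x)) xs)
                   ≤ variation δ (map p xs) + variation δ (map q xs)
variation-map₂ g p q []           = z≤n
variation-map₂ g p q (x ∷ [])     = z≤n
variation-map₂ g p q (x ∷ y ∷ xs) = begin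
  δ (g (p x) (q x)) (g (p y) (q y)) + variation δ (map (λ x → g (p x) (q x)) (y ∷ xs))
    ≤⟨ +-mono-≤ (δ-cong₂ g (p x) (p y) (q x) (q y)) (variation-map₂ g p q (y ∷ xs)) ⟩
  (δ (p x) (p y) + δ (q x) (q y)) + (variation δ (map p (y ∷ xs)) + variation δ (map q (y ∷ xs)))
    ≡⟨ interchange (δ (p x) (p y)) (δ (q x) (q y)) _ _ ⟩
  variation δ (map p (x ∷ y ∷ xs)) + variation δ (map q (x ∷ y ∷ xs)) ∎
  where open ≤-Reasoning

variation-sorted-true : ∀ {bs} → Linked _≤ᵇ_ (true ∷ bs) → variation δ (true ∷ bs) ≡ 0
variation-sorted-true [-]            = refl
variation-sorted-true (b≤b ∷ sorted) = variation-sorted-true sorted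

variation-sorted : ∀ {bs} → Linked _≤ᵇ_ bs → variation δ bs ≤ 1
variation-sorted []                     = z≤n
variation-sorted [-]                    = z≤n
variation-sorted {b ∷ _} (b≤b ∷ sorted) rewrite δ-refl b = variation-sorted sorted
variation-sorted (f≤t ∷ sorted)         rewrite variation-sorted-true sorted = ≤-refl

module _ {A : Set} (_≟_ : DecidableEquality A) where

  deduplicate-∷-∷ : ∀ {x y} xs → x ≡ y → deduplicate _≟_ (x ∷ y ∷ xs) ≡ deduplicate _≟_ (y ∷ xs)
  deduplicate-∷-∷ {x} xs refl = cong (x ∷_) (begin
    filter x≢? (x ∷ filter x≢? (deduplicate _≟_ xs)) ≡⟨ filter-reject x≢? (λ x≢x → x≢x refl) ⟩
    filter x≢? (filter x≢? (deduplicate _≟_ xs))     ≡⟨ filter-idem x≢? (deduplicate _≟_ xs) ⟩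
    filter x≢? (deduplicate _≟_ xs)                  ∎)
    where
    open ≡-Reasoning
    x≢? = ¬? ∘ (x ≟_)

  length-deduplicate≤1+variation : (d : A → A → ℕ) → (∀ {x y} → x ≢ y → 1 ≤ d x y) →
                                   ∀ xs → length (deduplicate _≟_ xs) ≤ suc (variation d xs)
  length-deduplicate≤1+variation d ≢⇒1≤d []           = z≤n
  length-deduplicate≤1+variation d ≢⇒1≤d (x ∷ [])     = ≤-refl
  length-deduplicate≤1+variation d ≢⇒1≤d (x ∷ y ∷ xs) =
    step (x ≟ y) (length-deduplicate≤1+variation d ≢⇒1≤d (y ∷ xs))
    where
    open ≤-Reasoning
    step : Dec (x ≡ y) →
           length (deduplicate _≟_ (y ∷ xs)) ≤ suc (variation d (y ∷ xs)) →
           length (deduplicate _≟_ (x ∷ y ∷ xs)) ≤ suc (variation d (x ∷ y ∷ xs))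
    step (yes x≡y) ih = begin
      length (deduplicate _≟_ (x ∷ y ∷ xs)) ≡⟨ cong length (deduplicate-∷-∷ xs x≡y) ⟩
      length (deduplicate _≟_ (y ∷ xs))     ≤⟨ ih ⟩
      suc (variation d (y ∷ xs))            ≤⟨ s≤s (m≤n+m _ _) ⟩
      suc (variation d (x ∷ y ∷ xs))        ∎
    step (no x≢y) ih = begin
      length (deduplicate _≟_ (x ∷ y ∷ xs))   ≤⟨ s≤s (length-filter (¬? ∘ (x ≟_)) _) ⟩
      suc (length (deduplicate _≟_ (y ∷ xs))) ≤⟨ s≤s ih ⟩
      suc (1 + variation d (y ∷ xs))          ≤⟨ s≤s (+-monoˡ-≤ _ (≢⇒1≤d x≢y)) ⟩
      suc (variation d (x ∷ y ∷ xs))          ∎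

hamming : ∀ {m} → Vec Bool m → Vec Bool m → ℕ
hamming []      []      = 0
hamming (b ∷ u) (c ∷ v) = δ b c + hamming u v

≢⇒1≤hamming : ∀ {m} {u v : Vec Bool m} → u ≢ v → 1 ≤ hamming u v
≢⇒1≤hamming {u = []}    {[]}    u≢v = contradiction refl u≢v
≢⇒1≤hamming {u = b ∷ u} {c ∷ v} bu≢cv with b ≟ᵇ c
... | yes refl = ≤-trans (≢⇒1≤hamming (bu≢cv ∘ cong (b ∷_))) (m≤n+m _ _)
... | no b≢c   = ≤-trans (≢⇒1≤δ b≢c) (m≤m+n _ _)

column : ∀ {A : Set} {m} → Fin m → List (Vec A m) → List A
column j = map (λ v → lookup v j)

column-suc : ∀ {A : Set} {m} (j : Fin m) (vs : List (Vec A (suc m))) →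
             column (suc j) vs ≡ column j (map tail vs)
column-suc j vs = trans (map-cong (λ { (_ ∷ _) → refl }) vs) (map-∘ vs)

variation-hamming-split : ∀ {m} (vs : List (Vec Bool (suc m))) →
                          variation hamming vs
                            ≡ variation δ (column zero vs) + variation hamming (map tail vs)
variation-hamming-split []                       = refl
variation-hamming-split (_ ∷ [])                 = refl
variation-hamming-split ((b ∷ u) ∷ (c ∷ w) ∷ vs) = begin
  (δ b c + hamming u w) + variation hamming ((c ∷ w) ∷ vs)
    ≡⟨ cong ((δ b c + hamming u w) +_) (variation-hamming-split ((c ∷ w) ∷ vs)) ⟩
  (δ b c + hamming u w) + (variation δ (column zero ((c ∷ w) ∷ vs)) + variation hamming (w ∷ map tail vs))
    ≡⟨ interchange (δ b c) (hamming u w) _ _ ⟩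
  variation δ (column zero ((b ∷ u) ∷ (c ∷ w) ∷ vs)) + variation hamming (u ∷ w ∷ map tail vs) ∎
  where open ≡-Reasoning

variation-hamming-zero : (vs : List (Vec Bool 0)) → variation hamming vs ≡ 0
variation-hamming-zero []             = refl
variation-hamming-zero (_ ∷ [])       = refl
variation-hamming-zero ([] ∷ [] ∷ vs) = variation-hamming-zero ([] ∷ vs)

variation-hamming : ∀ {m} (vs : List (Vec Bool m)) →
                    variation hamming vs ≡ ∑[ j < m ] variation δ (column j vs)
variation-hamming {zero}  vs = variation-hamming-zero vs
variation-hamming {suc m} vs = begin
  variation hamming vs
    ≡⟨ variation-hamming-split vs ⟩
  variation δ (column zero vs) + variation hamming (map tail vs)
    ≡⟨ cong (variation δ (column zero vs) +_) (variation-hamming (map tail vs)) ⟩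
  variation δ (column zero vs) + ∑[ j < m ] variation δ (column j (map tail vs))
    ≡⟨ cong (variation δ (column zero vs) +_) (sum-cong-≗ (λ j → cong (variation δ) (sym (column-suc j vs)))) ⟩
  ∑[ j < suc m ] variation δ (column j vs) ∎
  where open ≡-Reasoning

∑-supported-≤ : ∀ {m} k (S : Subset m) (f : Fin m → ℕ) →
                (∀ j → j ∈ S → f j ≤ k) → (∀ j → j ∉ S → f j ≡ 0) →
                ∑[ j < m ] f j ≤ k * ∣ S ∣
∑-supported-≤ k []          f _    _     = z≤n
∑-supported-≤ k (true ∷ S) f in-S off-S = begin
  f zero + ∑[ j < _ ] f (suc j)
    ≤⟨ +-mono-≤ (in-S zero here)
                (∑-supported-≤ k S (f ∘ suc) (λ j → in-S (suc j) ∘ there)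
                                             (λ j j∉S → off-S (suc j) λ { (there j∈S) → j∉S j∈S })) ⟩
  k + k * ∣ S ∣ ≡⟨ *-suc k ∣ S ∣ ⟨
  k * ∣ true ∷ S ∣ ∎
  where open ≤-Reasoning
∑-supported-≤ k (false ∷ S) f in-S off-S = begin
  f zero + ∑[ j < _ ] f (suc j)
    ≡⟨ cong (_+ ∑[ j < _ ] f (suc j)) (off-S zero λ ()) ⟩
  ∑[ j < _ ] f (suc j)
    ≤⟨ ∑-supported-≤ k S (f ∘ suc) (λ j → in-S (suc j) ∘ there)
                                   (λ j j∉S → off-S (suc j) λ { (there j∈S) → j∉S j∈S }) ⟩
  k * ∣ S ∣ ∎
  where open ≤-Reasoning

Linked-map-All : ∀ {A : Set} {P : A → Set} {R Q : A → A → Set} →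
                 (∀ {x y} → P x → P y → R x y → Q x y) →
                 ∀ {xs} → All P xs → Linked R xs → Linked Q xs
Linked-map-All f []             []       = []
Linked-map-All f (px ∷ [])      [-]      = [-]
Linked-map-All f (px ∷ py ∷ ps) (r ∷ rs) = f px py r ∷ Linked-map-All f (py ∷ ps) rs

does-mono : ∀ {P Q : Set} → (P → Q) → (p? : Dec P) (q? : Dec Q) → does p? ≤ᵇ does q?
does-mono P⇒Q (yes p) q?     rewrite dec-true q? (P⇒Q p) = b≤b
does-mono P⇒Q (no _)  (yes _) = f≤t
does-mono P⇒Q (no _)  (no _)  = b≤b

does-flip : ∀ {A : Set} {_≺_ : A → A → Set} → Trichotomous _≡_ _≺_ →
            ∀ {x y} → x ≢ y → (x≺?y : Dec (x ≺ y)) (y≺?x : Dec (y ≺ x)) →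
            does x≺?y ≡ not (does y≺?x)
does-flip cmp {x} {y} x≢y x≺?y y≺?x with cmp x y
... | tri< x≺y _ y⊀x rewrite dec-true x≺?y x≺y | dec-false y≺?x y⊀x = refl
... | tri≈ _ x≡y _   = contradiction x≡y x≢y
... | tri> x⊀y _ y≺x rewrite dec-false x≺?y x⊀y | dec-true y≺?x y≺x = refl

∧-∨-xor : ∀ x y → (not x ∧ y) ∨ (x ∧ not y) ≡ x xor y
∧-∨-xor true  y = refl
∧-∨-xor false y = ∨-identityʳ y

module _ {n} (a : Array n) (S : Subset n) where

  positionsN : List (Fin n)
  positionsN = filter (λ i → ¬? (i ∈? S)) (allFin n)

  positionsN-∉S : All (_∉ S) positionsN
  positionsN-∉S = all-filter (λ i → ¬? (i ∈? S)) (allFin n)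

  column-labelsOfN : ∀ j → column j (labelsOfN a S)
                           ≡ map (λ i → does (j ∈? S) ∧ inversion? a i j) positionsN
  column-labelsOfN j = trans (sym (map-∘ positionsN)) (map-cong (λ i → lookup∘tabulate _ j) positionsN)

  sorted-along-N : (f : Fin n → Bool) → (∀ {i i'} → i ∉ S → i' ∉ S → i < i' → f i ≤ᵇ f i') →
                   Linked _≤ᵇ_ (map f positionsN)
  sorted-along-N f mono = Linked.map⁺ (Linked-map-All mono positionsN-∉S
    (Linked.filter⁺ _ Fin.<-trans (Linked.AllPairs⇒Linked (AllPairs.tabulate⁺-< id))))

  module _ (inj : Injective _≡_ _≡_ a)
           (incr : ∀ i j → i ∉ S → j ∉ S → i < j → a i <ℕ a j)
           (j : Fin n) (j∈S : j ∈ S) where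

    ∉S⇒≢j : ∀ {i} → i ∉ S → i ≢ j
    ∉S⇒≢j i∉S refl = i∉S j∈S

    inversion?≡xor : ∀ {i} → i ∉ S → inversion? a i j ≡ does (j <? i) xor does (a j <ℕ? a i)
    inversion?≡xor {i} i∉S
      rewrite does-flip Fin.<-cmp (∉S⇒≢j i∉S) (i <? j) (j <? i)
            | does-flip <ℕ-cmp (∉S⇒≢j i∉S ∘ inj) (a i <ℕ? a j) (a j <ℕ? a i)
      = ∧-∨-xor (does (j <? i)) (does (a j <ℕ? a i))

    variation-inversions≤2 : variation δ (map (λ i → inversion? a i j) positionsN) ≤ 2
    variation-inversions≤2 = begin
      variation δ (map (λ i → inversion? a i j) positionsN)
        ≡⟨ cong (variation δ) (map-cong-local (All.map inversion?≡xor positionsN-∉S)) ⟩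
      variation δ (map (λ i → does (j <? i) xor does (a j <ℕ? a i)) positionsN)
        ≤⟨ variation-map₂ _xor_ (λ i → does (j <? i)) (λ i → does (a j <ℕ? a i)) positionsN ⟩
      variation δ (map (λ i → does (j <? i)) positionsN) + variation δ (map (λ i → does (a j <ℕ? a i)) positionsN)
        ≤⟨ +-mono-≤ (variation-sorted after-j-sorted) (variation-sorted above-a-j-sorted) ⟩
      2 ∎
      where
      open ≤-Reasoning
      after-j-sorted : Linked _≤ᵇ_ (map (λ i → does (j <? i)) positionsN)
      after-j-sorted = sorted-along-N (λ i → does (j <? i)) λ {i} {i'} _ _ i<i' →
        does-mono (λ j<i → Fin.<-trans j<i i<i') (j <? i) (j <? i')
      above-a-j-sorted : Linked _≤ᵇ_ (map (λ i → does (a j <ℕ? a i)) positionsN)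
      above-a-j-sorted = sorted-along-N (λ i → does (a j <ℕ? a i)) λ {i} {i'} i∉S i'∉S i<i' →
        does-mono (λ aj<ai → <-trans aj<ai (incr i i' i∉S i'∉S i<i')) (a j <ℕ? a i) (a j <ℕ? a i')

    variation-column≤2 : variation δ (column j (labelsOfN a S)) ≤ 2
    variation-column≤2 rewrite column-labelsOfN j | dec-true (j ∈? S) j∈S = variation-inversions≤2

  variation-column≡0 : ∀ j → j ∉ S → variation δ (column j (labelsOfN a S)) ≡ 0
  variation-column≡0 j j∉S rewrite column-labelsOfN j | dec-false (j ∈? S) j∉S =
    variation-const δ refl positionsN

lemma8 : (n : ℕ) (a : Array n) (S : Subset n)
         → Injective _≡_ _≡_ a
         → (∀ i j → i ∉ S → j ∉ S → i < j → a i <ℕ a j)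
         → numDistinctLabels a S ≤ 2 * ∣ S ∣ + 1
lemma8 n a S inj incr = begin
  numDistinctLabels a S
    ≤⟨ length-deduplicate≤1+variation (≡-dec _≟ᵇ_) hamming ≢⇒1≤hamming (labelsOfN a S) ⟩
  suc (variation hamming (labelsOfN a S))
    ≡⟨ cong suc (variation-hamming (labelsOfN a S)) ⟩
  suc (∑[ j < n ] variation δ (column j (labelsOfN a S)))
    ≤⟨ s≤s (∑-supported-≤ 2 S _ (variation-column≤2 a S inj incr) (variation-column≡0 a S)) ⟩
  suc (2 * ∣ S ∣)
    ≡⟨ +-comm 1 (2 * ∣ S ∣) ⟩
  2 * ∣ S ∣ + 1 ∎
  where open ≤-Reasoning
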